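{- Let $s\ge 2$ be an integer and let $G$ be a strict $2K_2$-split graph with $2K_2$-split partition $(C,S,I)$. Then $G$ is $(s,\infty)$-polar if and only if either $s\ge |C|$, or there is a subset $C'\subseteq C$ with at least $|C|-s+2$ vertices such that no vertex of $C'$ is adjacent to any vertex of $I$.
   Context: All graphs are finite and simple. A $2K_2$-split partition of $G$ is a partition $(C,S,I)$ of $V_G$ with $C$ a clique, $I$ independent, $S=\varnothing$ or $G[S]\cong 2K_2$, every vertex of $C$ adjacent to every vertex of $S$, and no edges between $I$ and $S$; $G$ is strict $2K_2$-split if it has such a partition with $S\neq\varnothing$ (then it is unique). $G$ is $(s,\infty)$-polar if $V_G$ has a partition $(A,B)$ with $G[A]$ a complete multipartite graph with at most $s$ parts and $G[B]$ a disjoint union of complete graphs. -}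

module Defs where

open import Data.Nat using (ℕ; _≤_; _∸_; _+_)
open import Data.Fin using (Fin)
open import Data.Fin.Subset using (Subset; _∈_; _∉_; _⊆_; ∣_∣)
open import Data.Bool using (Bool; true; false)
open import Data.Vec using (tabulate)
open import Data.Product using (Σ; _×_; ∃; ∃-syntax)
open import Data.Sum using (_⊎_)
open import Relation.Nullary using (¬_)
open import Relation.Binary.PropositionalEquality using (_≡_; _≢_)
open import Function.Bundles using (_⇔_)

record Graph (n : ℕ) : Set where
  field
    adj    : Fin n → Fin n → Bool
    sym    : ∀ u v → adj u v ≡ adj v u
    irrefl : ∀ v → adj v v ≡ false

open Graph public

Adj : ∀ {n} → Graph n → Fin n → Fin n → Set
Adj G u v = adj G u v ≡ true

Induces2K2 : ∀ {n} → Graph n → Subset n → Set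
Induces2K2 {n} G X =
  Σ (Fin n) λ a → Σ (Fin n) λ b → Σ (Fin n) λ c → Σ (Fin n) λ d →
    (a ≢ b) × (a ≢ c) × (a ≢ d) × (b ≢ c) × (b ≢ d) × (c ≢ d)
  × (a ∈ X) × (b ∈ X) × (c ∈ X) × (d ∈ X)
  × (∀ v → v ∈ X → (v ≡ a) ⊎ (v ≡ b) ⊎ (v ≡ c) ⊎ (v ≡ d))
  × Adj G a b × Adj G c d
  × ¬ Adj G a c × ¬ Adj G a d × ¬ Adj G b c × ¬ Adj G b d

IsPartition3 : ∀ {n} → Subset n → Subset n → Subset n → Set
IsPartition3 {n} C S I =
  ∀ v → ((v ∈ C) × (v ∉ S) × (v ∉ I))
      ⊎ ((v ∉ C) × (v ∈ S) × (v ∉ I))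
      ⊎ ((v ∉ C) × (v ∉ S) × (v ∈ I))

IsClique : ∀ {n} → Graph n → Subset n → Set
IsClique G X = ∀ u v → u ∈ X → v ∈ X → u ≢ v → Adj G u v

IsIndependent : ∀ {n} → Graph n → Subset n → Set
IsIndependent G X = ∀ u v → u ∈ X → v ∈ X → ¬ Adj G u v

-- (C,S,I) is a 2K₂-split partition with S ≠ ∅ (so G[S] ≅ 2K₂);
-- a graph admitting such a partition is strict 2K₂-split.
IsStrict2K2SplitPartition : ∀ {n} → Graph n → Subset n → Subset n → Subset n → Set
IsStrict2K2SplitPartition G C S I =
    IsPartition3 C S I
  × IsClique G C
  × IsIndependent G I
  × Induces2K2 G S
  × (∀ u v → u ∈ C → v ∈ S → Adj G u v)
  × (∀ u v → u ∈ I → v ∈ S → ¬ Adj G u v)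

-- G[A] is complete multipartite with at most s parts: there is an
-- assignment of the vertices of A to s (possibly empty) parts such that
-- two distinct vertices of A are adjacent iff they lie in different parts.
IsCompleteMultipartiteAtMost : ∀ {n} → Graph n → ℕ → Subset n → Set
IsCompleteMultipartiteAtMost {n} G s A =
  Σ (Fin n → Fin s) λ part →
    ∀ u v → u ∈ A → v ∈ A → u ≢ v → (Adj G u v ⇔ part u ≢ part v)

IsDisjointUnionOfCliques : ∀ {n} → Graph n → Subset n → Set
IsDisjointUnionOfCliques {n} G B =
  Σ (Fin n → ℕ) λ comp →
    ∀ u v → u ∈ B → v ∈ B → u ≢ v → (Adj G u v ⇔ comp u ≡ comp v)

-- G is (s,∞)-polar: V_G = A ⊔ B (B the complement of A) with G[A]
-- complete multipartite with ≤ s parts and G[B] a disjoint union of cliques.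
IsPolar : ∀ {n} → ℕ → Graph n → Set
IsPolar {n} s G =
  Σ (Subset n) λ A →
    IsCompleteMultipartiteAtMost G s A
  × IsDisjointUnionOfCliques G (tabulate λ v → notIn A v)
  where
  open import Data.Vec using (lookup)
  open import Data.Bool using (not)
  notIn : Subset n → Fin n → Bool
  notIn A v = not (lookup A v)

-- Write G[S] as the two edges ab and cd. If |C| ≤ s, take A = C with one
-- part per vertex; B = S ∪ I is then the two edges plus isolated vertices.
-- Given C', take A = (C ∖ C') ∪ {c, d}, a clique on at most s vertices, and
-- B = (C' ∪ {a, b}) ∪ I, a clique plus isolated vertices.
-- Conversely, let (A, B) be a polar partition with |C| > s. A clique meets
-- each part of A at most once, so some x ∈ C lies in B. Every vertex of S in
-- B is adjacent to x, hence in the component of x; since non-adjacency is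
-- transitive in A, this forces an edge pq of S into A and a vertex z of S
-- into B. Then (C ∩ A) ∪ {p, q} is a clique in A, so C' = C ∖ A has at least
-- |C| − s + 2 vertices, and none of them has a neighbour v ∈ I: in A, v would
-- share the parts of both p and q; in B, v would share the component of z.
module Submission where

open import Defs hiding (sym)
open import Data.Nat using (ℕ; suc; z≤n; s≤s; _≤_; _<_; _∸_; _+_; _*_; _≤?_; NonZero)
open import Data.Nat.Properties
  using (+-suc; +-assoc; +-comm; +-monoʳ-≤; +-monoˡ-≤; +-cancelˡ-≤; +-cancelʳ-≤;
         m∸n+n≡m; m≤n+m∸n; <-≤-trans; ≰⇒>; <⇒≤; suc-injective; *-cancelˡ-≡;
         even≢odd; module ≤-Reasoning)
open import Data.Nat.DivMod using (_mod_; m<n⇒m%n≡m)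
open import Data.Fin using (Fin; zero; suc; toℕ)
import Data.Fin.Properties as Finₚ
open import Data.Fin.Properties using (_≟_; toℕ-injective; toℕ-fromℕ<; injective⇒≤)
open import Data.Fin.Subset using (Subset; _∈_; _∉_; _⊆_; ∣_∣; ∁; ⁅_⁆; _∪_; _∩_; _─_; inside; outside)
open import Data.Fin.Subset.Properties
  using (_∈?_; nonempty?; x∈⁅x⁆; x∈⁅y⁆⇒x≡y; x∈p∪q⁺; x∈p∪q⁻; x∈p∩q⁺; x∈p∩q⁻;
         p∩q⊆q; x∈p∧x∉q⇒x∈p─q; p─q⊆p; x∈∁p⇒x∉p; x∉p⇒x∈∁p; ∪-identityʳ; ⊆-antisym)
open import Data.Vec using (_∷_; []; here; there; lookup; tabulate; map)
open import Data.Vec.Properties using (tabulate-∘; tabulate∘lookup)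
open import Data.Bool using (not)
open import Data.Product using (Σ; _×_; _,_; proj₁; proj₂)
open import Data.Sum using (_⊎_; inj₁; inj₂)
import Data.Sum as Sum
open import Data.Empty using (⊥-elim)
open import Function using (_∘_)
open import Relation.Nullary using (¬_; yes; no; contradiction)
open import Relation.Binary.PropositionalEquality
  using (_≡_; _≢_; refl; sym; trans; cong; subst; module ≡-Reasoning)
open import Function.Bundles using (_⇔_; mk⇔; Equivalence)

private
  variable
    n s : ℕ
    u v w x y : Fin n
    A B B′ B₁ B₂ K L : Subset n

[m+n]∸o+2≤n : (m n o : ℕ) → m + 2 ≤ o → o ≤ m + n → m + n ∸ o + 2 ≤ n
[m+n]∸o+2≤n m n o m+2≤o o≤m+n = +-cancelʳ-≤ m (m + n ∸ o + 2) n (begin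
  m + n ∸ o + 2 + m    ≡⟨ +-assoc (m + n ∸ o) 2 m ⟩
  m + n ∸ o + (2 + m)  ≡⟨ cong (m + n ∸ o +_) (+-comm 2 m) ⟩
  m + n ∸ o + (m + 2)  ≤⟨ +-monoʳ-≤ (m + n ∸ o) m+2≤o ⟩
  m + n ∸ o + o        ≡⟨ m∸n+n≡m o≤m+n ⟩
  m + n                ≡⟨ +-comm m n ⟩
  n + m                ∎)
  where open ≤-Reasoning

[m+n]∸o+2≤m⇒n+2≤o : (m n o : ℕ) → m + n ∸ o + 2 ≤ m → n + 2 ≤ o
[m+n]∸o+2≤m⇒n+2≤o m n o bound = +-cancelˡ-≤ m (n + 2) o (begin
  m + (n + 2)          ≡⟨ +-assoc m n 2 ⟨
  m + n + 2            ≤⟨ +-monoˡ-≤ 2 (m≤n+m∸n (m + n) o) ⟩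
  o + (m + n ∸ o) + 2  ≡⟨ +-assoc o (m + n ∸ o) 2 ⟩
  o + (m + n ∸ o + 2)  ≤⟨ +-monoʳ-≤ o bound ⟩
  o + m                ≡⟨ +-comm o m ⟩
  m + o                ∎)
  where open ≤-Reasoning

x∈p─q⇒x∉q : (p q : Subset n) → x ∈ p ─ q → x ∉ q
x∈p─q⇒x∉q (inside ∷ p) (outside ∷ q) here ()
x∈p─q⇒x∉q (_ ∷ p) (_ ∷ q) (there x∈p─q) (there x∈q) = x∈p─q⇒x∉q p q x∈p─q x∈q

∣p∣≡∣p∩q∣+∣p─q∣ : (p q : Subset n) → ∣ p ∣ ≡ ∣ p ∩ q ∣ + ∣ p ─ q ∣
∣p∣≡∣p∩q∣+∣p─q∣ [] [] = refl
∣p∣≡∣p∩q∣+∣p─q∣ (inside ∷ p) (inside ∷ q) = cong suc (∣p∣≡∣p∩q∣+∣p─q∣ p q)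
∣p∣≡∣p∩q∣+∣p─q∣ (inside ∷ p) (outside ∷ q) =
  trans (cong suc (∣p∣≡∣p∩q∣+∣p─q∣ p q)) (sym (+-suc _ _))
∣p∣≡∣p∩q∣+∣p─q∣ (outside ∷ p) (inside ∷ q) = ∣p∣≡∣p∩q∣+∣p─q∣ p q
∣p∣≡∣p∩q∣+∣p─q∣ (outside ∷ p) (outside ∷ q) = ∣p∣≡∣p∩q∣+∣p─q∣ p q

∣p∪⁅x⁆∣≡1+∣p∣ : (p : Subset n) → x ∉ p → ∣ p ∪ ⁅ x ⁆ ∣ ≡ suc ∣ p ∣
∣p∪⁅x⁆∣≡1+∣p∣ {x = zero} (inside ∷ p) x∉p = contradiction here x∉p
∣p∪⁅x⁆∣≡1+∣p∣ {x = zero} (outside ∷ p) _ = cong (suc ∘ ∣_∣) (∪-identityʳ p)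
∣p∪⁅x⁆∣≡1+∣p∣ {x = suc x} (inside ∷ p) x∉p = cong suc (∣p∪⁅x⁆∣≡1+∣p∣ p (x∉p ∘ there))
∣p∪⁅x⁆∣≡1+∣p∣ {x = suc x} (outside ∷ p) x∉p = ∣p∪⁅x⁆∣≡1+∣p∣ p (x∉p ∘ there)

x∈p∪⁅y⁆⁻ : (p : Subset n) → x ∈ p ∪ ⁅ y ⁆ → x ∈ p ⊎ x ≡ y
x∈p∪⁅y⁆⁻ p = Sum.map₂ (x∈⁅y⁆⇒x≡y _) ∘ x∈p∪q⁻ p _

y∈p∪⁅y⁆ : (p : Subset n) → y ∈ p ∪ ⁅ y ⁆
y∈p∪⁅y⁆ {y = y} p = x∈p∪q⁺ (inj₂ (x∈⁅x⁆ y))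

x∈p∪⁅y⁆∪⁅z⁆⁻ : {z : Fin n} (p : Subset n) → x ∈ (p ∪ ⁅ y ⁆) ∪ ⁅ z ⁆ → x ∈ p ⊎ x ≡ y ⊎ x ≡ z
x∈p∪⁅y⁆∪⁅z⁆⁻ p x∈ with x∈p∪⁅y⁆⁻ (p ∪ ⁅ _ ⁆) x∈
... | inj₂ x≡z = inj₂ (inj₂ x≡z)
... | inj₁ x∈′ = Sum.map₂ inj₁ (x∈p∪⁅y⁆⁻ p x∈′)

∣p∪⁅x⁆∪⁅y⁆∣≡∣p∣+2 : (p : Subset n) → x ∉ p → y ∉ p → x ≢ y → ∣ (p ∪ ⁅ x ⁆) ∪ ⁅ y ⁆ ∣ ≡ ∣ p ∣ + 2
∣p∪⁅x⁆∪⁅y⁆∣≡∣p∣+2 {x = x} {y} p x∉p y∉p x≢y = begin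
  ∣ (p ∪ ⁅ x ⁆) ∪ ⁅ y ⁆ ∣  ≡⟨ ∣p∪⁅x⁆∣≡1+∣p∣ (p ∪ ⁅ x ⁆) y∉p∪⁅x⁆ ⟩
  suc ∣ p ∪ ⁅ x ⁆ ∣        ≡⟨ cong suc (∣p∪⁅x⁆∣≡1+∣p∣ p x∉p) ⟩
  suc (suc ∣ p ∣)          ≡⟨ +-comm 2 ∣ p ∣ ⟩
  ∣ p ∣ + 2                ∎
  where
  open ≡-Reasoning
  y∉p∪⁅x⁆ : y ∉ p ∪ ⁅ x ⁆
  y∉p∪⁅x⁆ y∈ with x∈p∪⁅y⁆⁻ p y∈
  ... | inj₁ y∈p = y∉p y∈p
  ... | inj₂ refl = x≢y refl

-- IsPolar writes the complement of A in this form.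
tabulate-not≡∁ : (A : Subset n) → tabulate (λ v → not (lookup A v)) ≡ ∁ A
tabulate-not≡∁ A = trans (tabulate-∘ not (lookup A)) (cong (map not) (tabulate∘lookup A))

InjectiveOn : {B : Set} → Subset n → (Fin n → B) → Set
InjectiveOn p f = ∀ {x y} → x ∈ p → y ∈ p → f x ≡ f y → x ≡ y

enumerate : (p : Subset n) → Fin ∣ p ∣ → Fin n
enumerate (inside ∷ p) zero = zero
enumerate (inside ∷ p) (suc i) = suc (enumerate p i)
enumerate (outside ∷ p) i = suc (enumerate p i)

enumerate-∈ : (p : Subset n) (i : Fin ∣ p ∣) → enumerate p i ∈ p
enumerate-∈ (inside ∷ p) zero = here
enumerate-∈ (inside ∷ p) (suc i) = there (enumerate-∈ p i)
enumerate-∈ (outside ∷ p) i = there (enumerate-∈ p i)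

enumerate-injective : (p : Subset n) {i j : Fin ∣ p ∣} → enumerate p i ≡ enumerate p j → i ≡ j
enumerate-injective (inside ∷ p) {zero} {zero} _ = refl
enumerate-injective (inside ∷ p) {suc i} {suc j} e =
  cong suc (enumerate-injective p (Finₚ.suc-injective e))
enumerate-injective (outside ∷ p) e = enumerate-injective p (Finₚ.suc-injective e)

injectiveOn⇒∣p∣≤ : {m : ℕ} (p : Subset n) (f : Fin n → Fin m) → InjectiveOn p f → ∣ p ∣ ≤ m
injectiveOn⇒∣p∣≤ p f inj =
  injective⇒≤ (enumerate-injective p ∘ inj (enumerate-∈ p _) (enumerate-∈ p _))

rank : Subset n → Fin n → ℕ
rank (_ ∷ p) zero = 0
rank (inside ∷ p) (suc x) = suc (rank p x)
rank (outside ∷ p) (suc x) = rank p x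

rank<∣p∣ : (p : Subset n) → x ∈ p → rank p x < ∣ p ∣
rank<∣p∣ (inside ∷ p) here = s≤s z≤n
rank<∣p∣ (inside ∷ p) (there x∈p) = s≤s (rank<∣p∣ p x∈p)
rank<∣p∣ (outside ∷ p) (there x∈p) = rank<∣p∣ p x∈p

rank-injectiveOn : (p : Subset n) → InjectiveOn p (rank p)
rank-injectiveOn (_ ∷ p) here here _ = refl
rank-injectiveOn (inside ∷ p) (there x∈p) (there y∈p) e =
  cong suc (rank-injectiveOn p x∈p y∈p (suc-injective e))
rank-injectiveOn (outside ∷ p) (there x∈p) (there y∈p) e =
  cong suc (rank-injectiveOn p x∈p y∈p e)
rank-injectiveOn (inside ∷ p) here (there _) ()
rank-injectiveOn (inside ∷ p) (there _) here ()

module _ (G : Graph n) where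

  Adj-sym : Adj G u v → Adj G v u
  Adj-sym {u} {v} uv = trans (Graph.sym G v u) uv

  Adj⇒≢ : Adj G u v → u ≢ v
  Adj⇒≢ {u} uv refl with trans (sym uv) (Graph.irrefl G u)
  ... | ()

  clique-⊆ : L ⊆ K → IsClique G K → IsClique G L
  clique-⊆ L⊆K clq u v u∈L v∈L = clq u v (L⊆K u∈L) (L⊆K v∈L)

  clique-⁅⁆ : IsClique G ⁅ x ⁆
  clique-⁅⁆ {x = x} u v u∈ v∈ u≢v = contradiction (trans (x∈⁅y⁆⇒x≡y x u∈) (sym (x∈⁅y⁆⇒x≡y x v∈))) u≢v

  clique-∪⁅⁆ : IsClique G K → (∀ u → u ∈ K → Adj G u x) → IsClique G (K ∪ ⁅ x ⁆)
  clique-∪⁅⁆ {K = K} clq joined u v u∈ v∈ u≢v with x∈p∪⁅y⁆⁻ K u∈ | x∈p∪⁅y⁆⁻ K v∈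
  ... | inj₁ u∈K | inj₁ v∈K = clq u v u∈K v∈K u≢v
  ... | inj₁ u∈K | inj₂ refl = joined u u∈K
  ... | inj₂ refl | inj₁ v∈K = Adj-sym (joined v v∈K)
  ... | inj₂ refl | inj₂ refl = contradiction refl u≢v

  edge-clique : Adj G x y → IsClique G (⁅ x ⁆ ∪ ⁅ y ⁆)
  edge-clique {x = x} xy = clique-∪⁅⁆ clique-⁅⁆ λ u u∈ → subst (λ t → Adj G t _) (sym (x∈⁅y⁆⇒x≡y x u∈)) xy

  clique-∪-edge : IsClique G K → Adj G x y → (∀ u → u ∈ K → Adj G u x) → (∀ u → u ∈ K → Adj G u y) →
    IsClique G ((K ∪ ⁅ x ⁆) ∪ ⁅ y ⁆)
  clique-∪-edge {K = K} {x} {y} clq xy joinedˣ joinedʸ = clique-∪⁅⁆ (clique-∪⁅⁆ clq joinedˣ) joined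
    where
    joined : ∀ u → u ∈ K ∪ ⁅ x ⁆ → Adj G u y
    joined u u∈ with x∈p∪⁅y⁆⁻ K u∈
    ... | inj₁ u∈K = joinedʸ u u∈K
    ... | inj₂ refl = xy

  module CompleteMultipartite (mp : IsCompleteMultipartiteAtMost G s A) where

    part : Fin n → Fin s
    part = proj₁ mp

    Adj⇒part≢ : u ∈ A → v ∈ A → Adj G u v → part u ≢ part v
    Adj⇒part≢ {u} {v} u∈A v∈A uv = Equivalence.to (proj₂ mp u v u∈A v∈A (Adj⇒≢ uv)) uv

    ¬Adj⇒part≡ : u ∈ A → v ∈ A → ¬ Adj G u v → part u ≡ part v
    ¬Adj⇒part≡ {u} {v} u∈A v∈A ¬uv with u ≟ v | part u ≟ part v
    ... | yes refl | _ = refl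
    ... | no _ | yes same = same
    ... | no u≢v | no differ = contradiction (Equivalence.from (proj₂ mp u v u∈A v∈A u≢v) differ) ¬uv

    ¬Adj-trans : u ∈ A → v ∈ A → w ∈ A → ¬ Adj G u v → ¬ Adj G u w → ¬ Adj G v w
    ¬Adj-trans u∈A v∈A w∈A ¬uv ¬uw vw =
      Adj⇒part≢ v∈A w∈A vw (trans (sym (¬Adj⇒part≡ u∈A v∈A ¬uv)) (¬Adj⇒part≡ u∈A w∈A ¬uw))

    ∣clique∣≤parts : IsClique G K → K ⊆ A → ∣ K ∣ ≤ s
    ∣clique∣≤parts {K = K} clq K⊆A = injectiveOn⇒∣p∣≤ K part injective
      where
      injective : InjectiveOn K part
      injective {u} {v} u∈K v∈K same with u ≟ v
      ... | yes u≡v = u≡v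
      ... | no u≢v = contradiction same (Adj⇒part≢ (K⊆A u∈K) (K⊆A v∈K) (clq u v u∈K v∈K u≢v))

  -- A part map into Fin s needs s ≢ 0 even when K is empty.
  clique⇒multipartite : .{{_ : NonZero s}} → IsClique G K → ∣ K ∣ ≤ s → IsCompleteMultipartiteAtMost G s K
  clique⇒multipartite {s = s} {K = K} clq ∣K∣≤s = part , λ u v u∈K v∈K u≢v →
    mk⇔ (λ _ → u≢v ∘ part-injective u∈K v∈K) (λ _ → clq u v u∈K v∈K u≢v)
    where
    part : Fin n → Fin s
    part v = rank K v mod s

    toℕ-part : v ∈ K → toℕ (part v) ≡ rank K v
    toℕ-part v∈K = trans (toℕ-fromℕ< _) (m<n⇒m%n≡m (<-≤-trans (rank<∣p∣ K v∈K) ∣K∣≤s))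

    part-injective : InjectiveOn K part
    part-injective u∈K v∈K same =
      rank-injectiveOn K u∈K v∈K (trans (sym (toℕ-part u∈K)) (trans (cong toℕ same) (toℕ-part v∈K)))

  module DisjointUnionOfCliques (uc : IsDisjointUnionOfCliques G B) where

    component : Fin n → ℕ
    component = proj₁ uc

    Adj⇒component≡ : u ∈ B → v ∈ B → Adj G u v → component u ≡ component v
    Adj⇒component≡ {u} {v} u∈B v∈B uv = Equivalence.to (proj₂ uc u v u∈B v∈B (Adj⇒≢ uv)) uv

    Adj-trans : u ∈ B → v ∈ B → w ∈ B → Adj G u v → Adj G u w → v ≢ w → Adj G v w
    Adj-trans {u} {v} {w} u∈B v∈B w∈B uv uw v≢w = Equivalence.from (proj₂ uc v w v∈B w∈B v≢w)
      (trans (sym (Adj⇒component≡ u∈B v∈B uv)) (Adj⇒component≡ u∈B w∈B uw))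

  unionOfCliques-⊆ : B′ ⊆ B → IsDisjointUnionOfCliques G B → IsDisjointUnionOfCliques G B′
  unionOfCliques-⊆ B′⊆B (comp , spec) = comp , λ u v u∈ v∈ → spec u v (B′⊆B u∈) (B′⊆B v∈)

  clique⇒unionOfCliques : IsClique G K → IsDisjointUnionOfCliques G K
  clique⇒unionOfCliques clq = (λ _ → 0) , λ u v u∈K v∈K u≢v →
    mk⇔ (λ _ → refl) (λ _ → clq u v u∈K v∈K u≢v)

  independent⇒unionOfCliques : IsIndependent G K → IsDisjointUnionOfCliques G K
  independent⇒unionOfCliques ind = toℕ , λ u v u∈K v∈K u≢v →
    mk⇔ (⊥-elim ∘ ind u v u∈K v∈K) (⊥-elim ∘ u≢v ∘ toℕ-injective)

  unionOfCliques-∪ : IsDisjointUnionOfCliques G B₁ → IsDisjointUnionOfCliques G B₂ →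
    (∀ u v → u ∈ B₁ → v ∈ B₂ → ¬ Adj G u v) → IsDisjointUnionOfCliques G (B₁ ∪ B₂)
  unionOfCliques-∪ {B₁ = B₁} {B₂ = B₂} (comp₁ , spec₁) (comp₂ , spec₂) apart = comp , spec
    where
    comp : Fin n → ℕ
    comp v with v ∈? B₁
    ... | yes _ = 2 * comp₁ v
    ... | no _ = suc (2 * comp₂ v)

    in₂ : u ∈ B₁ ∪ B₂ → u ∉ B₁ → u ∈ B₂
    in₂ {u} u∈ u∉B₁ with x∈p∪q⁻ B₁ B₂ u∈
    ... | inj₁ u∈B₁ = contradiction u∈B₁ u∉B₁
    ... | inj₂ u∈B₂ = u∈B₂

    spec : ∀ u v → u ∈ B₁ ∪ B₂ → v ∈ B₁ ∪ B₂ → u ≢ v → (Adj G u v ⇔ comp u ≡ comp v)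
    spec u v u∈ v∈ u≢v with u ∈? B₁ | v ∈? B₁
    ... | yes u∈B₁ | yes v∈B₁ = mk⇔ (cong (2 *_) ∘ Equivalence.to (spec₁ u v u∈B₁ v∈B₁ u≢v))
                                    (Equivalence.from (spec₁ u v u∈B₁ v∈B₁ u≢v) ∘ *-cancelˡ-≡ (comp₁ u) (comp₁ v) 2)
    ... | yes u∈B₁ | no v∉B₁ = mk⇔ (⊥-elim ∘ apart u v u∈B₁ (in₂ v∈ v∉B₁)) (⊥-elim ∘ even≢odd (comp₁ u) (comp₂ v))
    ... | no u∉B₁ | yes v∈B₁ = mk⇔ (⊥-elim ∘ apart v u v∈B₁ (in₂ u∈ u∉B₁) ∘ Adj-sym)
                                    (⊥-elim ∘ even≢odd (comp₁ v) (comp₂ u) ∘ sym)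
    ... | no u∉B₁ | no v∉B₁ =
      mk⇔ (cong (λ k → suc (2 * k)) ∘ Equivalence.to (spec₂ u v (in₂ u∈ u∉B₁) (in₂ v∈ v∉B₁) u≢v))
          (Equivalence.from (spec₂ u v (in₂ u∈ u∉B₁) (in₂ v∈ v∉B₁) u≢v) ∘ *-cancelˡ-≡ (comp₂ u) (comp₂ v) 2 ∘ suc-injective)

  polar-intro : IsCompleteMultipartiteAtMost G s A → IsDisjointUnionOfCliques G (∁ A) → IsPolar s G
  polar-intro {A = A} mp uc = A , mp , subst (IsDisjointUnionOfCliques G) (sym (tabulate-not≡∁ A)) uc

  polar-elim : IsPolar s G →
    Σ (Subset n) λ A → IsCompleteMultipartiteAtMost G s A × IsDisjointUnionOfCliques G (∁ A)
  polar-elim (A , mp , uc) = A , mp , subst (IsDisjointUnionOfCliques G) (tabulate-not≡∁ A) uc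

record Strict2K2Split (G : Graph n) (C S I : Subset n) : Set where
  field
    partition     : IsPartition3 C S I
    C-clique      : IsClique G C
    I-independent : IsIndependent G I
    a b c d       : Fin n
    a∈S           : a ∈ S
    b∈S           : b ∈ S
    c∈S           : c ∈ S
    d∈S           : d ∈ S
    S⊆abcd        : ∀ v → v ∈ S → (v ≡ a) ⊎ (v ≡ b) ⊎ (v ≡ c) ⊎ (v ≡ d)
    a≢c           : a ≢ c
    a≢d           : a ≢ d
    b≢c           : b ≢ c
    b≢d           : b ≢ d
    ab            : Adj G a b
    cd            : Adj G c d
    ¬ac           : ¬ Adj G a c
    ¬ad           : ¬ Adj G a d
    ¬bc           : ¬ Adj G b c
    ¬bd           : ¬ Adj G b d
    C-S           : ∀ u v → u ∈ C → v ∈ S → Adj G u v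
    I-S           : ∀ u v → u ∈ I → v ∈ S → ¬ Adj G u v

strict2K2Split : {G : Graph n} {C S I : Subset n} → IsStrict2K2SplitPartition G C S I → Strict2K2Split G C S I
strict2K2Split (partition , C-clique , I-independent ,
                (a , b , c , d , _ , a≢c , a≢d , b≢c , b≢d , _ , a∈S , b∈S , c∈S , d∈S , S⊆abcd ,
                 ab , cd , ¬ac , ¬ad , ¬bc , ¬bd) , C-S , I-S) = record
  { partition = partition ; C-clique = C-clique ; I-independent = I-independent
  ; a = a ; b = b ; c = c ; d = d ; a∈S = a∈S ; b∈S = b∈S ; c∈S = c∈S ; d∈S = d∈S ; S⊆abcd = S⊆abcd
  ; a≢c = a≢c ; a≢d = a≢d ; b≢c = b≢c ; b≢d = b≢d
  ; ab = ab ; cd = cd ; ¬ac = ¬ac ; ¬ad = ¬ad ; ¬bc = ¬bc ; ¬bd = ¬bd ; C-S = C-S ; I-S = I-S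
  }

module Strict2K2SplitPolarity {G : Graph n} {C S I : Subset n} (σ : Strict2K2Split G C S I) where
  open Strict2K2Split σ

  S⇒∉C : v ∈ S → v ∉ C
  S⇒∉C {v} v∈S v∈C with partition v
  ... | inj₁ (_ , v∉S , _) = v∉S v∈S
  ... | inj₂ (inj₁ (v∉C , _)) = v∉C v∈C
  ... | inj₂ (inj₂ (v∉C , _)) = v∉C v∈C

  S⇒∉I : v ∈ S → v ∉ I
  S⇒∉I {v} v∈S v∈I with partition v
  ... | inj₁ (_ , _ , v∉I) = v∉I v∈I
  ... | inj₂ (inj₁ (_ , _ , v∉I)) = v∉I v∈I
  ... | inj₂ (inj₂ (_ , v∉S , _)) = v∉S v∈S

  ∉C⇒S⊎I : v ∉ C → v ∈ S ⊎ v ∈ I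
  ∉C⇒S⊎I {v} v∉C with partition v
  ... | inj₁ (v∈C , _) = contradiction v∈C v∉C
  ... | inj₂ (inj₁ (_ , v∈S , _)) = inj₁ v∈S
  ... | inj₂ (inj₂ (_ , _ , v∈I)) = inj₂ v∈I

  S-unionOfCliques : IsDisjointUnionOfCliques G S
  S-unionOfCliques = unionOfCliques-⊆ G S⊆ab∪cd
    (unionOfCliques-∪ G (clique⇒unionOfCliques G (edge-clique G ab))
                        (clique⇒unionOfCliques G (edge-clique G cd)) ab-cd-apart)
    where
    pair⁻ : ∀ {x y} → v ∈ ⁅ x ⁆ ∪ ⁅ y ⁆ → v ≡ x ⊎ v ≡ y
    pair⁻ = Sum.map₁ (x∈⁅y⁆⇒x≡y _) ∘ x∈p∪⁅y⁆⁻ ⁅ _ ⁆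

    S⊆ab∪cd : S ⊆ (⁅ a ⁆ ∪ ⁅ b ⁆) ∪ (⁅ c ⁆ ∪ ⁅ d ⁆)
    S⊆ab∪cd {v} v∈S with S⊆abcd v v∈S
    ... | inj₁ refl = x∈p∪q⁺ (inj₁ (x∈p∪q⁺ (inj₁ (x∈⁅x⁆ v))))
    ... | inj₂ (inj₁ refl) = x∈p∪q⁺ (inj₁ (y∈p∪⁅y⁆ _))
    ... | inj₂ (inj₂ (inj₁ refl)) = x∈p∪q⁺ (inj₂ (x∈p∪q⁺ (inj₁ (x∈⁅x⁆ v))))
    ... | inj₂ (inj₂ (inj₂ refl)) = x∈p∪q⁺ (inj₂ (y∈p∪⁅y⁆ _))

    ab-cd-apart : ∀ u v → u ∈ ⁅ a ⁆ ∪ ⁅ b ⁆ → v ∈ ⁅ c ⁆ ∪ ⁅ d ⁆ → ¬ Adj G u v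
    ab-cd-apart u v u∈ v∈ with pair⁻ u∈ | pair⁻ v∈
    ... | inj₁ refl | inj₁ refl = ¬ac
    ... | inj₁ refl | inj₂ refl = ¬ad
    ... | inj₂ refl | inj₁ refl = ¬bc
    ... | inj₂ refl | inj₂ refl = ¬bd

  polar-if-∣C∣≤s : .{{_ : NonZero s}} → ∣ C ∣ ≤ s → IsPolar s G
  polar-if-∣C∣≤s ∣C∣≤s = polar-intro G (clique⇒multipartite G C-clique ∣C∣≤s)
    (unionOfCliques-⊆ G ∁C⊆S∪I
      (unionOfCliques-∪ G S-unionOfCliques (independent⇒unionOfCliques G I-independent)
        λ u v u∈S v∈I → I-S v u v∈I u∈S ∘ Adj-sym G))
    where
    ∁C⊆S∪I : ∁ C ⊆ S ∪ I
    ∁C⊆S∪I = x∈p∪q⁺ ∘ ∉C⇒S⊎I ∘ x∈∁p⇒x∉p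

  polar-if-C′ : .{{_ : NonZero s}} → (C′ : Subset n) → C′ ⊆ C → ∣ C ∣ ∸ s + 2 ≤ ∣ C′ ∣ →
    (∀ u v → u ∈ C′ → v ∈ I → ¬ Adj G u v) → IsPolar s G
  polar-if-C′ {s = s} C′ C′⊆C bound C′-I = polar-intro G (clique⇒multipartite G A′-clique ∣A′∣≤s)
    (unionOfCliques-⊆ G ∁A′⊆K′∪I
      (unionOfCliques-∪ G (clique⇒unionOfCliques G K′-clique) (independent⇒unionOfCliques G I-independent) K′-I))
    where
    A′ K′ : Subset n
    A′ = ((C ─ C′) ∪ ⁅ c ⁆) ∪ ⁅ d ⁆
    K′ = (C′ ∪ ⁅ a ⁆) ∪ ⁅ b ⁆

    A′-clique : IsClique G A′
    A′-clique = clique-∪-edge G (clique-⊆ G (p─q⊆p C C′) C-clique) cd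
      (λ u u∈ → C-S u c (p─q⊆p C C′ u∈) c∈S) (λ u u∈ → C-S u d (p─q⊆p C C′ u∈) d∈S)

    ∣C∣≡∣C′∣+∣C─C′∣ : ∣ C ∣ ≡ ∣ C′ ∣ + ∣ C ─ C′ ∣
    ∣C∣≡∣C′∣+∣C─C′∣ = trans (∣p∣≡∣p∩q∣+∣p─q∣ C C′)
      (cong (λ t → ∣ t ∣ + ∣ C ─ C′ ∣) (⊆-antisym (p∩q⊆q C C′) (λ v∈C′ → x∈p∩q⁺ (C′⊆C v∈C′ , v∈C′))))

    ∣A′∣≤s : ∣ A′ ∣ ≤ s
    ∣A′∣≤s = subst (_≤ s)
      (sym (∣p∪⁅x⁆∪⁅y⁆∣≡∣p∣+2 (C ─ C′) (S⇒∉C c∈S ∘ p─q⊆p C C′) (S⇒∉C d∈S ∘ p─q⊆p C C′) (Adj⇒≢ G cd)))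
      ([m+n]∸o+2≤m⇒n+2≤o ∣ C′ ∣ ∣ C ─ C′ ∣ s (subst (λ t → t ∸ s + 2 ≤ ∣ C′ ∣) ∣C∣≡∣C′∣+∣C─C′∣ bound))

    K′-clique : IsClique G K′
    K′-clique = clique-∪-edge G (clique-⊆ G C′⊆C C-clique) ab
      (λ u u∈ → C-S u a (C′⊆C u∈) a∈S) (λ u u∈ → C-S u b (C′⊆C u∈) b∈S)

    K′-I : ∀ u v → u ∈ K′ → v ∈ I → ¬ Adj G u v
    K′-I u v u∈K′ v∈I with x∈p∪⁅y⁆∪⁅z⁆⁻ C′ u∈K′
    ... | inj₁ u∈C′ = C′-I u v u∈C′ v∈I
    ... | inj₂ (inj₁ refl) = I-S v a v∈I a∈S ∘ Adj-sym G
    ... | inj₂ (inj₂ refl) = I-S v b v∈I b∈S ∘ Adj-sym G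

    ∁A′⊆K′∪I : ∁ A′ ⊆ K′ ∪ I
    ∁A′⊆K′∪I {v} v∈∁A′ with x∈∁p⇒x∉p v∈∁A′ | partition v
    ... | v∉A′ | inj₁ (v∈C , _) with v ∈? C′
    ...   | yes v∈C′ = x∈p∪q⁺ (inj₁ (x∈p∪q⁺ (inj₁ (x∈p∪q⁺ (inj₁ v∈C′)))))
    ...   | no v∉C′ = contradiction (x∈p∪q⁺ (inj₁ (x∈p∪q⁺ (inj₁ (x∈p∧x∉q⇒x∈p─q v∈C v∉C′))))) v∉A′
    ∁A′⊆K′∪I {v} v∈∁A′ | v∉A′ | inj₂ (inj₁ (_ , v∈S , _)) with S⊆abcd v v∈S
    ... | inj₁ refl = x∈p∪q⁺ (inj₁ (x∈p∪q⁺ (inj₁ (y∈p∪⁅y⁆ C′))))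
    ... | inj₂ (inj₁ refl) = x∈p∪q⁺ (inj₁ (y∈p∪⁅y⁆ _))
    ... | inj₂ (inj₂ (inj₁ refl)) = contradiction (x∈p∪q⁺ (inj₁ (y∈p∪⁅y⁆ _))) v∉A′
    ... | inj₂ (inj₂ (inj₂ refl)) = contradiction (y∈p∪⁅y⁆ _) v∉A′
    ∁A′⊆K′∪I {v} v∈∁A′ | _ | inj₂ (inj₂ (_ , _ , v∈I)) = x∈p∪q⁺ (inj₂ v∈I)

  record EdgeInsideVertexOutside (A : Subset n) : Set where
    field
      p q z : Fin n
      p∈S   : p ∈ S
      q∈S   : q ∈ S
      z∈S   : z ∈ S
      p∈A   : p ∈ A
      q∈A   : q ∈ A
      z∉A   : z ∉ A
      pq    : Adj G p q

  module _ (mp : IsCompleteMultipartiteAtMost G s A) (uc : IsDisjointUnionOfCliques G (∁ A)) where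
    open CompleteMultipartite G mp
    open DisjointUnionOfCliques G uc

    -- y and w lie in the component of x.
    S∖A-adjacent : x ∈ C ─ A → y ∈ S → w ∈ S → y ∉ A → w ∉ A → y ≢ w → Adj G y w
    S∖A-adjacent {x = x} {y} {w} x∈C─A y∈S w∈S y∉A w∉A =
      Adj-trans (x∉p⇒x∈∁p (x∈p─q⇒x∉q C A x∈C─A)) (x∉p⇒x∈∁p y∉A) (x∉p⇒x∈∁p w∉A)
        (C-S x y (p─q⊆p C A x∈C─A) y∈S) (C-S x w (p─q⊆p C A x∈C─A) w∈S)

    edgeInsideVertexOutside : x ∈ C ─ A → EdgeInsideVertexOutside A
    edgeInsideVertexOutside x∈C─A with a ∈? A | b ∈? A | c ∈? A | d ∈? A
    ... | yes a∈A | yes b∈A | yes c∈A | _ =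
      contradiction ab (¬Adj-trans c∈A a∈A b∈A (¬ac ∘ Adj-sym G) (¬bc ∘ Adj-sym G))
    ... | yes a∈A | yes b∈A | no c∉A | _ = record
      { p∈S = a∈S ; q∈S = b∈S ; z∈S = c∈S ; p∈A = a∈A ; q∈A = b∈A ; z∉A = c∉A ; pq = ab }
    ... | yes _ | no b∉A | yes c∈A | yes d∈A = record
      { p∈S = c∈S ; q∈S = d∈S ; z∈S = b∈S ; p∈A = c∈A ; q∈A = d∈A ; z∉A = b∉A ; pq = cd }
    ... | yes _ | no b∉A | no c∉A | _ = contradiction (S∖A-adjacent x∈C─A b∈S c∈S b∉A c∉A b≢c) ¬bc
    ... | yes _ | no b∉A | yes _ | no d∉A = contradiction (S∖A-adjacent x∈C─A b∈S d∈S b∉A d∉A b≢d) ¬bd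
    ... | no a∉A | _ | yes c∈A | yes d∈A = record
      { p∈S = c∈S ; q∈S = d∈S ; z∈S = a∈S ; p∈A = c∈A ; q∈A = d∈A ; z∉A = a∉A ; pq = cd }
    ... | no a∉A | _ | no c∉A | _ = contradiction (S∖A-adjacent x∈C─A a∈S c∈S a∉A c∉A a≢c) ¬ac
    ... | no a∉A | _ | yes _ | no d∉A = contradiction (S∖A-adjacent x∈C─A a∈S d∈S a∉A d∉A a≢d) ¬ad

    module _ (e : EdgeInsideVertexOutside A) where
      open EdgeInsideVertexOutside e

      ∣C∣∸s+2≤∣C─A∣ : s ≤ ∣ C ∣ → ∣ C ∣ ∸ s + 2 ≤ ∣ C ─ A ∣
      ∣C∣∸s+2≤∣C─A∣ s≤∣C∣ = subst (λ t → t ∸ s + 2 ≤ ∣ C ─ A ∣) (sym ∣C∣≡)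
        ([m+n]∸o+2≤n ∣ C ∩ A ∣ ∣ C ─ A ∣ s ∣C∩A∣+2≤s (subst (s ≤_) ∣C∣≡ s≤∣C∣))
        where
        ∣C∣≡ : ∣ C ∣ ≡ ∣ C ∩ A ∣ + ∣ C ─ A ∣
        ∣C∣≡ = ∣p∣≡∣p∩q∣+∣p─q∣ C A

        C∩A⊆C : C ∩ A ⊆ C
        C∩A⊆C = proj₁ ∘ x∈p∩q⁻ C A

        K′ : Subset n
        K′ = ((C ∩ A) ∪ ⁅ p ⁆) ∪ ⁅ q ⁆

        K′⊆A : K′ ⊆ A
        K′⊆A v∈K′ with x∈p∪⁅y⁆∪⁅z⁆⁻ (C ∩ A) v∈K′
        ... | inj₁ v∈C∩A = proj₂ (x∈p∩q⁻ C A v∈C∩A)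
        ... | inj₂ (inj₁ refl) = p∈A
        ... | inj₂ (inj₂ refl) = q∈A

        ∣C∩A∣+2≤s : ∣ C ∩ A ∣ + 2 ≤ s
        ∣C∩A∣+2≤s = subst (_≤ s) (∣p∪⁅x⁆∪⁅y⁆∣≡∣p∣+2 (C ∩ A) (S⇒∉C p∈S ∘ C∩A⊆C) (S⇒∉C q∈S ∘ C∩A⊆C) (Adj⇒≢ G pq))
          (∣clique∣≤parts (clique-∪-edge G (clique-⊆ G C∩A⊆C C-clique) pq
            (λ u u∈ → C-S u p (C∩A⊆C u∈) p∈S) (λ u u∈ → C-S u q (C∩A⊆C u∈) q∈S)) K′⊆A)

      C─A-I-nonadjacent : ∀ u v → u ∈ C ─ A → v ∈ I → ¬ Adj G u v
      C─A-I-nonadjacent u v u∈C─A v∈I uv with v ∈? A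
      ... | yes v∈A = ¬Adj-trans v∈A p∈A q∈A (I-S v p v∈I p∈S) (I-S v q v∈I q∈S) pq
      ... | no v∉A = I-S v z v∈I z∈S
        (Adj-trans (x∉p⇒x∈∁p (x∈p─q⇒x∉q C A u∈C─A)) (x∉p⇒x∈∁p v∉A) (x∉p⇒x∈∁p z∉A)
          uv (C-S u z (p─q⊆p C A u∈C─A) z∈S) (λ { refl → S⇒∉I z∈S v∈I }))

  PolarCriterion : ℕ → Set
  PolarCriterion s = ∣ C ∣ ≤ s ⊎ Σ (Subset n) λ C′ → C′ ⊆ C × (∣ C ∣ ∸ s + 2 ≤ ∣ C′ ∣)
    × (∀ u v → u ∈ C′ → v ∈ I → ¬ Adj G u v)

  polar⇒criterion : IsPolar s G → PolarCriterion s
  polar⇒criterion {s = s} polar with ∣ C ∣ ≤? s | polar-elim G polar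
  ... | yes ∣C∣≤s | _ = inj₁ ∣C∣≤s
  ... | no ∣C∣≰s | A , mp , uc with nonempty? (C ─ A)
  ...   | yes (x , x∈C─A) = inj₂ (C ─ A , p─q⊆p C A ,
            ∣C∣∸s+2≤∣C─A∣ mp uc e (<⇒≤ (≰⇒> ∣C∣≰s)) , C─A-I-nonadjacent mp uc e)
    where
    e : EdgeInsideVertexOutside A
    e = edgeInsideVertexOutside mp uc x∈C─A
  ...   | no C─A-empty = contradiction (CompleteMultipartite.∣clique∣≤parts G mp C-clique C⊆A) ∣C∣≰s
    where
    C⊆A : C ⊆ A
    C⊆A {v} v∈C with v ∈? A
    ... | yes v∈A = v∈A
    ... | no v∉A = contradiction (v , x∈p∧x∉q⇒x∈p─q v∈C v∉A) C─A-empty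

  criterion⇒polar : .{{_ : NonZero s}} → PolarCriterion s → IsPolar s G
  criterion⇒polar (inj₁ ∣C∣≤s) = polar-if-∣C∣≤s ∣C∣≤s
  criterion⇒polar (inj₂ (C′ , C′⊆C , bound , C′-I)) = polar-if-C′ C′ C′⊆C bound C′-I

mainTheorem15 : (s : ℕ) → 2 ≤ s → (n : ℕ) → (G : Graph n) →
    (C S I : Subset n) → IsStrict2K2SplitPartition G C S I →
    (IsPolar s G ⇔
      ((∣ C ∣ ≤ s)
      ⊎ Σ (Subset n) λ C' → C' ⊆ C × (∣ C ∣ ∸ s + 2 ≤ ∣ C' ∣)
          × (∀ u v → u ∈ C' → v ∈ I → ¬ Adj G u v)))
mainTheorem15 _ (s≤s (s≤s _)) _ G C S I split = mk⇔ polar⇒criterion criterion⇒polar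
  where open Strict2K2SplitPolarity (strict2K2Split {G = G} {C} {S} {I} split)
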